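{- Let $p$ be a prime, $q=p^{r}$, $k\geq 3$ with $k\mid(q-1)$, $F=\mathrm{GF}(q)$, and $\Phi$ the unique multiplicative subgroup of $F^{*}$ of order $k$. Suppose $(p,k)$ is circular and $k$ is even. Then $2\in\Phi$ if and only if $p=3$.
   Context: For a finite field $E$ and its multiplicative subgroup $\Psi$ of order $k$, the pair $(E,\Psi)$ is circular if $|\Psi a\cap(\Psi b+c)|\leq 2$ for all $a,b,c\in E^{*}$. The pair $(p,k)$ is called circular if $(\mathrm{GF}(p^{r'}),\Psi)$ is circular for some $r'\in\mathbb{N}$ with $k\mid(p^{r'}-1)$ ($\Psi$ the subgroup of order $k$); it is known (Modisett) that then $(\mathrm{GF}(p^{r}),\Phi)$ is circular for every $r$ with $k\mid(p^{r}-1)$. -}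

module Defs where

open import Level using (Level; _⊔_; 0ℓ)
open import Data.Nat using (ℕ; zero; suc)
open import Data.Fin using (Fin)
open import Data.Product using (Σ; ∃; _×_; _,_)
open import Data.Sum using (_⊎_)
open import Relation.Binary.PropositionalEquality using (_≡_)
open import Relation.Nullary using (¬_)
open import Algebra.Bundles using (CommutativeRing)

record IsFiniteField {c ℓ : Level} (F : CommutativeRing c ℓ) (q : ℕ) : Set (c ⊔ ℓ) where
  open CommutativeRing F
  field
    0≉1     : ¬ (0# ≈ 1#)
    inverse : ∀ x → ¬ (x ≈ 0#) → Σ Carrier (λ y → (x * y) ≈ 1#)
    enum    : Fin q → Carrier
    enum-injective  : ∀ i j → enum i ≈ enum j → i ≡ j
    enum-surjective : ∀ x → Σ (Fin q) (λ i → enum i ≈ x)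

module _ {c ℓ : Level} (F : CommutativeRing c ℓ) where
  open CommutativeRing F

  pow : Carrier → ℕ → Carrier
  pow x zero    = 1#
  pow x (suc n) = x * pow x n

  -- Φ_k = the subgroup of F* of order k, realised as the k-th roots of unity
  -- { ψ | ψ ^ k = 1 } (this is the unique subgroup of order k when k ∣ |F| - 1).
  InΦ : ℕ → Carrier → Set ℓ
  InΦ k ψ = pow ψ k ≈ 1#

  InCoset : ℕ → Carrier → Carrier → Set (c ⊔ ℓ)
  InCoset k a x = Σ Carrier (λ ψ → InΦ k ψ × (x ≈ (ψ * a)))

  InShiftedCoset : ℕ → Carrier → Carrier → Carrier → Set (c ⊔ ℓ)
  InShiftedCoset k b d x = Σ Carrier (λ ψ → InΦ k ψ × (x ≈ ((ψ * b) + d)))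

  AtMostTwoInIntersection : ℕ → Carrier → Carrier → Carrier → Set (c ⊔ ℓ)
  AtMostTwoInIntersection k a b d =
    ∀ x y z →
    InCoset k a x → InShiftedCoset k b d x →
    InCoset k a y → InShiftedCoset k b d y →
    InCoset k a z → InShiftedCoset k b d z →
    (x ≈ y) ⊎ (x ≈ z) ⊎ (y ≈ z)

  IsCircularField : ℕ → Set (c ⊔ ℓ)
  IsCircularField k =
    ∀ a b d → ¬ (a ≈ 0#) → ¬ (b ≈ 0#) → ¬ (d ≈ 0#) →
    AtMostTwoInIntersection k a b d

open import Data.Nat using (_^_; _∸_)
open import Data.Nat.Divisibility using (_∣_)

IsCircularPair : ℕ → ℕ → Set (Level.suc 0ℓ)
IsCircularPair p k =
  Σ ℕ λ r' → (k ∣ ((p ^ r') ∸ 1)) ×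
  Σ (CommutativeRing 0ℓ 0ℓ) λ E → IsFiniteField E (p ^ r') × IsCircularField E k

{-# OPTIONS --safe #-}
module Submission where

-- If 2 ∈ Φ in F then p ∣ 2^k − 1, so 2 ∈ Φ also in the circular field E, which has the same
-- characteristic p. There 2, 1/2 and −1 all lie in Φ ∩ (Φ + 1), as 1 + 1, (−1/2) + 1 and
-- (−2) + 1 (here −1 ∈ Φ because k is even), so two of them coincide; each coincidence
-- forces 3 = 0, i.e. p = 3. Conversely, in characteristic 3 we have 2 = −1 ∈ Φ.

open import Defs
open import Level using (Level)
open import Data.Nat using (ℕ; zero; suc; _^_; _∸_; _≤_; _<_; s≤s; z≤n)
import Data.Nat as ℕ
import Data.Nat.Properties as ℕₚ
open import Data.Nat.Divisibility using (_∣_; divides; n∣m*n)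
open import Data.Nat.GCD using (gcd; gcd-GCD; gcd[m,n]∣m; gcd[m,n]∣n; module Bézout)
open import Data.Nat.Primality using (Prime; prime?; prime⇒irreducible; ¬prime[1])
open import Data.Fin using (Fin)
import Data.Fin.Properties as Fin
open import Data.Fin.Permutation using (Permutation; permutation)
open import Data.Vec.Functional using (replicate)
open import Data.Product using (_,_; proj₁; proj₂)
open import Data.Sum using (_⊎_; inj₁; inj₂)
open import Function.Base using (_∘_)
open import Function.Bundles using (_⇔_; mk⇔; Equivalence)
open import Function.Construct.Composition using (_⇔-∘_)
open import Relation.Binary.Definitions using (Decidable)
open import Relation.Nullary using (¬_; yes; no; contradiction)
open import Relation.Nullary.Decidable using (from-yes)
import Relation.Binary.PropositionalEquality as ≡
open ≡ using (_≡_)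
open import Algebra.Bundles using (CommutativeRing)
import Algebra.Properties.CommutativeSemiring.Exp as CommutativeSemiringExp
import Algebra.Properties.Semiring.Mult as SemiringMult
import Algebra.Properties.Ring as RingProperties
import Algebra.Properties.CommutativeMonoid.Sum as CommutativeMonoidSum

open Equivalence using (to; from)

module Power {c ℓ : Level} (R : CommutativeRing c ℓ) where
  open CommutativeRing R
  open import Relation.Binary.Reasoning.Setoid setoid
  module Exp = CommutativeSemiringExp commutativeSemiring

  private variable
    x y : Carrier
    m n : ℕ

  pow≈^ : ∀ x n → pow R x n ≈ x Exp.^ n
  pow≈^ x zero    = refl
  pow≈^ x (suc n) = *-congˡ (pow≈^ x n)

  pow-congˡ : ∀ n → x ≈ y → pow R x n ≈ pow R y n
  pow-congˡ {x} {y} n x≈y = begin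
    pow R x n  ≈⟨ pow≈^ x n ⟩
    x Exp.^ n  ≈⟨ Exp.^-congˡ n x≈y ⟩
    y Exp.^ n  ≈⟨ pow≈^ y n ⟨
    pow R y n  ∎

  pow-distrib-* : ∀ x y n → pow R (x * y) n ≈ pow R x n * pow R y n
  pow-distrib-* x y n = begin
    pow R (x * y) n        ≈⟨ pow≈^ (x * y) n ⟩
    (x * y) Exp.^ n        ≈⟨ Exp.^-distrib-* x y n ⟩
    x Exp.^ n * y Exp.^ n  ≈⟨ *-cong (pow≈^ x n) (pow≈^ y n) ⟨
    pow R x n * pow R y n  ∎

  pow-assocʳ : ∀ x m n → pow R (pow R x m) n ≈ pow R x (m ℕ.* n)
  pow-assocʳ x m n = begin
    pow R (pow R x m) n    ≈⟨ pow-congˡ n (pow≈^ x m) ⟩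
    pow R (x Exp.^ m) n    ≈⟨ pow≈^ (x Exp.^ m) n ⟩
    (x Exp.^ m) Exp.^ n    ≈⟨ Exp.^-assocʳ x m n ⟩
    x Exp.^ (m ℕ.* n)      ≈⟨ pow≈^ x (m ℕ.* n) ⟨
    pow R x (m ℕ.* n)      ∎

  pow-1# : ∀ n → pow R 1# n ≈ 1#
  pow-1# zero    = refl
  pow-1# (suc n) = trans (*-identityˡ _) (pow-1# n)

  pow≈1-∣ : m ∣ n → pow R x m ≈ 1# → pow R x n ≈ 1#
  pow≈1-∣ {m} {x = x} (divides j ≡.refl) xᵐ≈1 = begin
    pow R x (j ℕ.* m)    ≡⟨ ≡.cong (pow R x) (ℕₚ.*-comm j m) ⟩
    pow R x (m ℕ.* j)    ≈⟨ pow-assocʳ x m j ⟨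
    pow R (pow R x m) j  ≈⟨ pow-congˡ j xᵐ≈1 ⟩
    pow R 1# j           ≈⟨ pow-1# j ⟩
    1#                   ∎

  pow-suc≈1⇒≉0 : ¬ 1# ≈ 0# → pow R x (suc n) ≈ 1# → ¬ x ≈ 0#
  pow-suc≈1⇒≉0 {x} {n} 1≉0 xⁿ⁺¹≈1 x≈0 = 1≉0 (begin
    1#               ≈⟨ xⁿ⁺¹≈1 ⟨
    x * pow R x n    ≈⟨ *-congʳ x≈0 ⟩
    0# * pow R x n   ≈⟨ zeroˡ _ ⟩
    0#               ∎)

module RootsOfUnity {c ℓ : Level} (R : CommutativeRing c ℓ) (k : ℕ) where
  open CommutativeRing R
  open RingProperties ring using (-1*x≈-x; -‿involutive)
  open Power R
  open import Relation.Binary.Reasoning.Setoid setoid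

  private variable
    x y : Carrier

  InΦ-cong : x ≈ y → InΦ R k x → InΦ R k y
  InΦ-cong x≈y x∈Φ = trans (pow-congˡ k (sym x≈y)) x∈Φ

  InΦ-1# : InΦ R k 1#
  InΦ-1# = pow-1# k

  InΦ-* : InΦ R k x → InΦ R k y → InΦ R k (x * y)
  InΦ-* {x} {y} x∈Φ y∈Φ = begin
    pow R (x * y) k        ≈⟨ pow-distrib-* x y k ⟩
    pow R x k * pow R y k  ≈⟨ *-cong x∈Φ y∈Φ ⟩
    1# * 1#                ≈⟨ *-identityˡ 1# ⟩
    1#                     ∎

  InΦ-inverse : InΦ R k x → x * y ≈ 1# → InΦ R k y
  InΦ-inverse {x} {y} x∈Φ xy≈1 = begin
    pow R y k              ≈⟨ *-identityˡ _ ⟨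
    1# * pow R y k         ≈⟨ *-congʳ x∈Φ ⟨
    pow R x k * pow R y k  ≈⟨ pow-distrib-* x y k ⟨
    pow R (x * y) k        ≈⟨ pow-congˡ k xy≈1 ⟩
    pow R 1# k             ≈⟨ pow-1# k ⟩
    1#                     ∎

  InΦ-[-1] : 2 ∣ k → InΦ R k (- 1#)
  InΦ-[-1] 2∣k = pow≈1-∣ 2∣k (begin
    - 1# * (- 1# * 1#)  ≈⟨ *-congˡ (*-identityʳ (- 1#)) ⟩
    - 1# * - 1#         ≈⟨ -1*x≈-x (- 1#) ⟩
    - - 1#              ≈⟨ -‿involutive 1# ⟩
    1#                  ∎)

  InΦ-neg : 2 ∣ k → InΦ R k x → InΦ R k (- x)
  InΦ-neg {x} 2∣k x∈Φ = InΦ-cong (-1*x≈-x x) (InΦ-* (InΦ-[-1] 2∣k) x∈Φ)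

module Characteristic {c ℓ : Level} (R : CommutativeRing c ℓ) where
  open CommutativeRing R
  open RingProperties ring using (+-identityʳ-unique; +-inverseˡ-unique)
  open SemiringMult semiring using (_×_; ×-homo-1; ×-homo-+; ×1-homo-*)
  open Power R using (pow-congˡ)
  open RootsOfUnity R using (InΦ-cong; InΦ-[-1])
  open import Relation.Binary.Reasoning.Setoid setoid

  private variable
    d m n p : ℕ

  ∣⇒×1≈0 : m × 1# ≈ 0# → m ∣ n → n × 1# ≈ 0#
  ∣⇒×1≈0 {m} m×1≈0 (divides j ≡.refl) = begin
    (j ℕ.* m) × 1#       ≈⟨ ×1-homo-* j m ⟩
    (j × 1#) * (m × 1#)  ≈⟨ *-congˡ m×1≈0 ⟩
    (j × 1#) * 0#        ≈⟨ zeroʳ _ ⟩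
    0#                   ∎

  +-cancel-×1≈0 : d ℕ.+ m ≡ n → m × 1# ≈ 0# → n × 1# ≈ 0# → d × 1# ≈ 0#
  +-cancel-×1≈0 {d} {m} {n} d+m≡n m×1≈0 n×1≈0 = begin
    d × 1#             ≈⟨ +-identityʳ _ ⟨
    d × 1# + 0#        ≈⟨ +-congˡ m×1≈0 ⟨
    d × 1# + m × 1#    ≈⟨ ×-homo-+ 1# d m ⟨
    (d ℕ.+ m) × 1#     ≡⟨ ≡.cong (_× 1#) d+m≡n ⟩
    n × 1#             ≈⟨ n×1≈0 ⟩
    0#                 ∎

  gcd-×1≈0 : ∀ m n → m × 1# ≈ 0# → n × 1# ≈ 0# → gcd m n × 1# ≈ 0#
  gcd-×1≈0 m n m×1≈0 n×1≈0 with Bézout.identity (gcd-GCD m n)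
  ... | Bézout.+- x y eq =
    +-cancel-×1≈0 {m = y ℕ.* n} eq (∣⇒×1≈0 n×1≈0 (n∣m*n y)) (∣⇒×1≈0 m×1≈0 (n∣m*n x))
  ... | Bézout.-+ x y eq =
    +-cancel-×1≈0 {m = x ℕ.* m} eq (∣⇒×1≈0 m×1≈0 (n∣m*n x)) (∣⇒×1≈0 n×1≈0 (n∣m*n y))

  prime-×1≈0⇒∣ : ¬ 1# ≈ 0# → Prime p → p × 1# ≈ 0# → n × 1# ≈ 0# → p ∣ n
  prime-×1≈0⇒∣ {p} {n} 1≉0 p-prime p×1≈0 n×1≈0
    with prime⇒irreducible p-prime (gcd[m,n]∣m p n)
  ... | inj₁ gcd≡1 = contradiction (trans (sym (×-homo-1 1#)) gcd×1≈0) 1≉0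
    where
    gcd×1≈0 : 1 × 1# ≈ 0#
    gcd×1≈0 = ≡.subst (λ g → g × 1# ≈ 0#) gcd≡1 (gcd-×1≈0 p n p×1≈0 n×1≈0)
  ... | inj₂ gcd≡p = ≡.subst (_∣ n) gcd≡p (gcd[m,n]∣n p n)

  ×1≈0⇔∣ : ¬ 1# ≈ 0# → Prime p → p × 1# ≈ 0# → ∀ n → n × 1# ≈ 0# ⇔ p ∣ n
  ×1≈0⇔∣ 1≉0 p-prime p×1≈0 n = mk⇔ (prime-×1≈0⇒∣ 1≉0 p-prime p×1≈0) (∣⇒×1≈0 p×1≈0)

  ^-×1 : ∀ m n → (m ^ n) × 1# ≈ pow R (m × 1#) n
  ^-×1 m zero    = ×-homo-1 1#
  ^-×1 m (suc n) = trans (×1-homo-* m (m ^ n)) (*-congˡ (^-×1 m n))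

  suc×1≈1⇔×1≈0 : suc n × 1# ≈ 1# ⇔ n × 1# ≈ 0#
  suc×1≈1⇔×1≈0 {n} = mk⇔
    (+-identityʳ-unique 1# (n × 1#))
    (λ n×1≈0 → trans (+-congˡ n×1≈0) (+-identityʳ 1#))

  1+1≈2×1 : 1# + 1# ≈ 2 × 1#
  1+1≈2×1 = +-congˡ (sym (+-identityʳ 1#))

  3×1≈0⇔1+1≈-1 : 3 × 1# ≈ 0# ⇔ 1# + 1# ≈ - 1#
  3×1≈0⇔1+1≈-1 = mk⇔
    (+-inverseˡ-unique (1# + 1#) 1# ∘ trans 2+1≈3×1)
    (λ 1+1≈-1 → trans (sym 2+1≈3×1) (trans (+-congʳ 1+1≈-1) (-‿inverseˡ 1#)))
    where
    2+1≈3×1 : (1# + 1#) + 1# ≈ 3 × 1#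
    2+1≈3×1 = trans (+-assoc 1# 1# 1#) (+-congˡ (+-congˡ (sym (+-identityʳ 1#))))

  3×1≈0⇒2∈Φ : 3 × 1# ≈ 0# → ∀ k → 2 ∣ k → InΦ R k (1# + 1#)
  3×1≈0⇒2∈Φ 3×1≈0 k 2∣k = InΦ-cong k (sym (to 3×1≈0⇔1+1≈-1 3×1≈0)) (InΦ-[-1] k 2∣k)

  2∈Φ⇔∣ : ¬ 1# ≈ 0# → Prime p → p × 1# ≈ 0# → ∀ k → InΦ R k (1# + 1#) ⇔ p ∣ 2 ^ k ∸ 1
  2∈Φ⇔∣ {p} 1≉0 p-prime p×1≈0 k =
    ×1≈0⇔∣ 1≉0 p-prime p×1≈0 (2 ^ k ∸ 1)
      ⇔-∘ (suc×1≈1⇔×1≈0 {2 ^ k ∸ 1} ⇔-∘ mk⇔ (trans (sym pow≈2^k×1)) (trans pow≈2^k×1))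
    where
    pow≈2^k×1 : pow R (1# + 1#) k ≈ suc (2 ^ k ∸ 1) × 1#
    pow≈2^k×1 = begin
      pow R (1# + 1#) k     ≈⟨ pow-congˡ k 1+1≈2×1 ⟩
      pow R (2 × 1#) k      ≈⟨ ^-×1 2 k ⟨
      (2 ^ k) × 1#          ≡⟨ ≡.cong (_× 1#) (ℕₚ.m+[n∸m]≡n (ℕₚ.m^n>0 2 k)) ⟨
      suc (2 ^ k ∸ 1) × 1#  ∎

module Circularity {c ℓ : Level} (R : CommutativeRing c ℓ) (k : ℕ) where
  open CommutativeRing R
  open RingProperties ring using (y≈x\\z; +-identityˡ-unique; +-inverseˡ-unique; -‿distribʳ-*)
  open RootsOfUnity R k using (InΦ-1#; InΦ-[-1]; InΦ-neg; InΦ-inverse)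
  open import Relation.Binary.Reasoning.Setoid setoid

  private variable
    h x ψ : Carrier

  2*x≈x+x : ∀ x → (1# + 1#) * x ≈ x + x
  2*x≈x+x x = trans (distribʳ x 1# 1#) (+-cong (*-identityˡ x) (*-identityˡ x))

  ∈Φ·1 : InΦ R k x → InCoset R k 1# x
  ∈Φ·1 {x = x} x∈Φ = x , x∈Φ , sym (*-identityʳ x)

  ∈Φ·1+1 : InΦ R k ψ → x ≈ ψ + 1# → InShiftedCoset R k 1# 1# x
  ∈Φ·1+1 {ψ = ψ} ψ∈Φ x≈ψ+1 = ψ , ψ∈Φ , trans x≈ψ+1 (+-congʳ (sym (*-identityʳ ψ)))

  coincidence⇒2≈-1 : (1# + 1#) * h ≈ 1# →
                     (1# + 1# ≈ h) ⊎ (1# + 1# ≈ - 1#) ⊎ (h ≈ - 1#) → 1# + 1# ≈ - 1#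
  coincidence⇒2≈-1 {h} 2h≈1 (inj₁ 2≈h) = +-inverseˡ-unique _ 1# (+-identityˡ-unique _ 1# (begin
    ((1# + 1#) + 1#) + 1#    ≈⟨ +-assoc _ 1# 1# ⟩
    (1# + 1#) + (1# + 1#)    ≈⟨ 2*x≈x+x (1# + 1#) ⟨
    (1# + 1#) * (1# + 1#)    ≈⟨ *-congˡ 2≈h ⟩
    (1# + 1#) * h            ≈⟨ 2h≈1 ⟩
    1#                       ∎))
  coincidence⇒2≈-1 2h≈1 (inj₂ (inj₁ 2≈-1)) = 2≈-1
  coincidence⇒2≈-1 {h} 2h≈1 (inj₂ (inj₂ h≈-1)) = +-inverseˡ-unique _ 1# (begin
    (1# + 1#) + 1#                   ≈⟨ +-congˡ 2h≈1 ⟨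
    (1# + 1#) + (1# + 1#) * h        ≈⟨ +-congˡ (*-congˡ h≈-1) ⟩
    (1# + 1#) + (1# + 1#) * - 1#     ≈⟨ +-congˡ (-‿distribʳ-* _ 1#) ⟨
    (1# + 1#) + - ((1# + 1#) * 1#)   ≈⟨ +-congˡ (-‿cong (*-identityʳ _)) ⟩
    (1# + 1#) + - (1# + 1#)          ≈⟨ -‿inverseʳ _ ⟩
    0#                               ∎)

  circular⇒2≈-1 : ¬ 1# ≈ 0# → IsCircularField R k → 2 ∣ k →
                  InΦ R k (1# + 1#) → (1# + 1#) * h ≈ 1# → 1# + 1# ≈ - 1#
  circular⇒2≈-1 {h} 1≉0 circular 2∣k 2∈Φ 2h≈1 = coincidence⇒2≈-1 2h≈1
    (circular 1# 1# 1# 1≉0 1≉0 1≉0 (1# + 1#) h (- 1#)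
      (∈Φ·1 2∈Φ) (∈Φ·1+1 InΦ-1# refl)
      (∈Φ·1 h∈Φ) (∈Φ·1+1 (InΦ-neg 2∣k h∈Φ) (y≈x\\z h h 1# (trans (sym (2*x≈x+x h)) 2h≈1)))
      (∈Φ·1 -1∈Φ) (∈Φ·1+1 (InΦ-neg 2∣k 2∈Φ) (y≈x\\z (1# + 1#) (- 1#) 1# 2-1≈1)))
    where
    h∈Φ : InΦ R k h
    h∈Φ = InΦ-inverse 2∈Φ 2h≈1
    -1∈Φ : InΦ R k (- 1#)
    -1∈Φ = InΦ-[-1] 2∣k
    2-1≈1 : (1# + 1#) - 1# ≈ 1#
    2-1≈1 = trans (+-assoc 1# 1# (- 1#)) (trans (+-congˡ (-‿inverseʳ 1#)) (+-identityʳ 1#))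

module FiniteField {c ℓ : Level} {F : CommutativeRing c ℓ} {q : ℕ} (F-finite : IsFiniteField F q) where
  open CommutativeRing F
  open IsFiniteField F-finite
  open RingProperties ring using (+-identityʳ-unique)
  open CommutativeMonoidSum +-commutativeMonoid using (sum; sum-permute; sum-cong-≋; ∑-distrib-+; sum-replicate)
  open SemiringMult semiring using (_×_)
  open Power F using (pow-suc≈1⇒≉0)
  open Characteristic F using (^-×1; ×1≈0⇔∣; 2∈Φ⇔∣)
  open import Relation.Binary.Reasoning.Setoid setoid

  private variable
    a b x y : Carrier

  1≉0 : ¬ 1# ≈ 0#
  1≉0 = 0≉1 ∘ sym

  index : Carrier → Fin q
  index x = proj₁ (enum-surjective x)

  enum-index : ∀ x → enum (index x) ≈ x
  enum-index x = proj₂ (enum-surjective x)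

  _≟_ : Decidable _≈_
  x ≟ y with index x Fin.≟ index y
  ... | yes ix≡iy = yes (begin
    x               ≈⟨ enum-index x ⟨
    enum (index x)  ≡⟨ ≡.cong enum ix≡iy ⟩
    enum (index y)  ≈⟨ enum-index y ⟩
    y               ∎)
  ... | no ix≢iy = no λ x≈y →
    ix≢iy (enum-injective _ _ (trans (enum-index x) (trans x≈y (sym (enum-index y)))))

  ≉0∧*≈0⇒≈0 : ¬ x ≈ 0# → x * y ≈ 0# → y ≈ 0#
  ≉0∧*≈0⇒≈0 {x} {y} x≉0 xy≈0 with inverse x x≉0
  ... | x⁻¹ , xx⁻¹≈1 = begin
    y               ≈⟨ *-identityˡ y ⟨
    1# * y          ≈⟨ *-congʳ (trans (*-comm x⁻¹ x) xx⁻¹≈1) ⟨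
    (x⁻¹ * x) * y   ≈⟨ *-assoc x⁻¹ x y ⟩
    x⁻¹ * (x * y)   ≈⟨ *-congˡ xy≈0 ⟩
    x⁻¹ * 0#        ≈⟨ zeroʳ x⁻¹ ⟩
    0#              ∎

  pow≈0⇒≈0 : ∀ n → pow F x n ≈ 0# → x ≈ 0#
  pow≈0⇒≈0 zero 1≈0 = contradiction 1≈0 1≉0
  pow≈0⇒≈0 {x} (suc n) xⁿ⁺¹≈0 with x ≟ 0#
  ... | yes x≈0 = x≈0
  ... | no x≉0 = pow≈0⇒≈0 n (≉0∧*≈0⇒≈0 x≉0 xⁿ⁺¹≈0)

  translate : Carrier → Fin q → Fin q
  translate a i = index (enum i + a)

  translate-inverse : a + b ≈ 0# → ∀ i → translate b (translate a i) ≡ i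
  translate-inverse {a} {b} a+b≈0 i = enum-injective _ _ (begin
    enum (translate b (translate a i))  ≈⟨ enum-index _ ⟩
    enum (translate a i) + b            ≈⟨ +-congʳ (enum-index _) ⟩
    (enum i + a) + b                    ≈⟨ +-assoc _ a b ⟩
    enum i + (a + b)                    ≈⟨ +-congˡ a+b≈0 ⟩
    enum i + 0#                         ≈⟨ +-identityʳ _ ⟩
    enum i                              ∎)

  translation : Carrier → Permutation q q
  translation a = permutation (translate a) (translate (- a))
    (translate-inverse (-‿inverseˡ a)) (translate-inverse (-‿inverseʳ a))

  q×a≈0 : ∀ a → q × a ≈ 0#
  q×a≈0 a = +-identityʳ-unique (sum enum) (q × a) (sym (begin
    sum enum                        ≈⟨ sum-permute enum (translation a) ⟩
    sum (enum ∘ translate a)        ≈⟨ sum-cong-≋ (λ i → enum-index (enum i + a)) ⟩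
    sum (λ i → enum i + a)          ≈⟨ ∑-distrib-+ enum (replicate q a) ⟩
    sum enum + sum (replicate q a)  ≈⟨ +-congˡ (sum-replicate q) ⟩
    sum enum + q × a                ∎))

  order≡p^r⇒p×1≈0 : ∀ {p r} → q ≡ p ^ r → p × 1# ≈ 0#
  order≡p^r⇒p×1≈0 {p} {r} q≡p^r = pow≈0⇒≈0 r (begin
    pow F (p × 1#) r  ≈⟨ ^-×1 p r ⟨
    (p ^ r) × 1#      ≡⟨ ≡.cong (_× 1#) q≡p^r ⟨
    q × 1#            ≈⟨ q×a≈0 1# ⟩
    0#                ∎)

  2∈Φ⇔p∣ : ∀ {p r} → Prime p → q ≡ p ^ r → ∀ k → InΦ F k (1# + 1#) ⇔ p ∣ 2 ^ k ∸ 1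
  2∈Φ⇔p∣ {r = r} p-prime q≡p^r = 2∈Φ⇔∣ 1≉0 p-prime (order≡p^r⇒p×1≈0 {r = r} q≡p^r)

  3×1≈0⇒p∣3 : ∀ {p r} → Prime p → q ≡ p ^ r → 3 × 1# ≈ 0# → p ∣ 3
  3×1≈0⇒p∣3 {r = r} p-prime q≡p^r = to (×1≈0⇔∣ 1≉0 p-prime (order≡p^r⇒p×1≈0 {r = r} q≡p^r) 3)

  circular⇒1+1≈-1 : ∀ k → 0 < k → IsCircularField F k → 2 ∣ k →
                    InΦ F k (1# + 1#) → 1# + 1# ≈ - 1#
  circular⇒1+1≈-1 (suc k) _ circular 2∣k 2∈Φ
    with inverse (1# + 1#) (pow-suc≈1⇒≉0 {n = k} 1≉0 2∈Φ)
  ... | h , 2h≈1 = Circularity.circular⇒2≈-1 F (suc k) 1≉0 circular 2∣k 2∈Φ 2h≈1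

prime∣prime⇒≡ : ∀ {p q} → Prime p → Prime q → p ∣ q → p ≡ q
prime∣prime⇒≡ p-prime q-prime p∣q with prime⇒irreducible q-prime p∣q
... | inj₁ ≡.refl = contradiction p-prime ¬prime[1]
... | inj₂ p≡q    = p≡q

-- Φ is modelled as the k-th roots of unity.
lemma6 : {c ℓ : Level} (p r k : ℕ) → Prime p → 3 ≤ k → k ∣ ((p ^ r) ∸ 1) →
         (F : CommutativeRing c ℓ) → IsFiniteField F (p ^ r) →
         IsCircularPair p k → 2 ∣ k →
         (InΦ F k (CommutativeRing._+_ F (CommutativeRing.1# F) (CommutativeRing.1# F)) ⇔ (p ≡ 3))
lemma6 p r k p-prime 3≤k _ F F-finite (r′ , _ , E , E-finite , E-circular) 2∣k =
  mk⇔ 2∈Φ⇒p≡3 p≡3⇒2∈Φ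
  where
  open CommutativeRing F using (_+_; 1#)
  module F = FiniteField F-finite
  module E = FiniteField E-finite

  2∈Φ⇒p≡3 : InΦ F k (1# + 1#) → p ≡ 3
  2∈Φ⇒p≡3 = prime∣prime⇒≡ p-prime (from-yes (prime? 3))
          ∘ E.3×1≈0⇒p∣3 {r = r′} p-prime ≡.refl
          ∘ from (Characteristic.3×1≈0⇔1+1≈-1 E)
          ∘ E.circular⇒1+1≈-1 k (ℕₚ.≤-trans (s≤s z≤n) 3≤k) E-circular 2∣k
          ∘ from (E.2∈Φ⇔p∣ {r = r′} p-prime ≡.refl k)
          ∘ to (F.2∈Φ⇔p∣ {r = r} p-prime ≡.refl k)

  p≡3⇒2∈Φ : p ≡ 3 → InΦ F k (1# + 1#)
  p≡3⇒2∈Φ ≡.refl = Characteristic.3×1≈0⇒2∈Φ F (F.order≡p^r⇒p×1≈0 {r = r} ≡.refl) k 2∣k
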